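{- Let $H$ and $K$ be subgroups of a group with $HK=KH$, so that $HK$ is a group, and let $HK$ act faithfully on a set $X$, with its subgroups acting by restriction. Then $D_{HK,H}(X)\geq D_{K,H\cap K}(X)$.
   Context: An $r$-labeling of $X$ is a surjection $\phi:X\to\{1,\ldots,r\}$; $g$ preserves $\phi$ if $\phi(g.x)=\phi(x)$ for all $x\in X$. For a group $\Gamma$ acting on $X$ and $L\leqslant\Gamma$, $D_{\Gamma,L}(X)$ is the smallest $r$ such that there is an $r$-labeling of $X$ all of whose preserving elements of $\Gamma$ lie in $L$. -}

module Defs where

open import Level using (Level; _⊔_; suc)
open import Algebra.Bundles using (Group)
open import Data.Nat using (ℕ; _≤_)
open import Data.Fin using (Fin)
open import Data.Product using (Σ; ∃; _×_; _,_)
open import Relation.Unary using (Pred; _∈_)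
open import Relation.Binary.PropositionalEquality using (_≡_)

module _ {c ℓ : Level} (G : Group c ℓ) where
  open Group G

  record IsSubgroup {p : Level} (S : Pred Carrier p) : Set (c ⊔ ℓ ⊔ p) where
    field
      resp   : ∀ {x y} → x ≈ y → x ∈ S → y ∈ S
      ε∈     : ε ∈ S
      ∙-closed : ∀ {x y} → x ∈ S → y ∈ S → (x ∙ y) ∈ S
      ⁻¹-closed : ∀ {x} → x ∈ S → (x ⁻¹) ∈ S

  _·_ : ∀ {p q} → Pred Carrier p → Pred Carrier q → Pred Carrier (c ⊔ ℓ ⊔ p ⊔ q)
  (S · T) g = Σ Carrier λ s → Σ Carrier λ t → s ∈ S × t ∈ T × g ≈ (s ∙ t)

  _∩_ : ∀ {p q} → Pred Carrier p → Pred Carrier q → Pred Carrier (p ⊔ q)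
  (S ∩ T) g = g ∈ S × g ∈ T

  SameSet : ∀ {p q} → Pred Carrier p → Pred Carrier q → Set (c ⊔ p ⊔ q)
  SameSet S T = (∀ g → g ∈ S → g ∈ T) × (∀ g → g ∈ T → g ∈ S)

  -- A (left) action of the subgroup Γ of G on the set X, given by a map
  -- act : Carrier → X → X whose values are only constrained on elements of Γ.
  record IsActionOf {p x : Level} (Γ : Pred Carrier p) (X : Set x)
                    (act : Carrier → X → X) : Set (c ⊔ ℓ ⊔ p ⊔ x) where
    field
      act-resp : ∀ {g h} → g ∈ Γ → h ∈ Γ → g ≈ h → ∀ z → act g z ≡ act h z
      act-ε    : ∀ z → act ε z ≡ z
      act-∙    : ∀ {g h} → g ∈ Γ → h ∈ Γ → ∀ z → act (g ∙ h) z ≡ act g (act h z)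

  IsFaithful : ∀ {p x} (Γ : Pred Carrier p) (X : Set x) (act : Carrier → X → X) → Set (c ⊔ ℓ ⊔ p ⊔ x)
  IsFaithful Γ X act = ∀ g → g ∈ Γ → (∀ z → act g z ≡ z) → g ≈ ε

  -- An r-labeling of X: a surjection X → Fin r  (Fin r ≅ {1,…,r}).
  IsLabeling : ∀ {x} {X : Set x} (r : ℕ) → (X → Fin r) → Set x
  IsLabeling {X = X} r φ = ∀ (i : Fin r) → ∃ λ (z : X) → φ z ≡ i

  Preserves : ∀ {x} {X : Set x} {r : ℕ} (act : Carrier → X → X) → Carrier → (X → Fin r) → Set x
  Preserves act g φ = ∀ z → φ (act g z) ≡ φ z

  HasDistLabeling : ∀ {p q x} (Γ : Pred Carrier p) (L : Pred Carrier q) (X : Set x)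
                    (act : Carrier → X → X) (r : ℕ) → Set (c ⊔ p ⊔ q ⊔ x)
  HasDistLabeling Γ L X act r =
    Σ (X → Fin r) λ φ → IsLabeling r φ × (∀ g → g ∈ Γ → Preserves act g φ → g ∈ L)

  IsD : ∀ {p q x} (Γ : Pred Carrier p) (L : Pred Carrier q) (X : Set x)
        (act : Carrier → X → X) (d : ℕ) → Set (c ⊔ p ⊔ q ⊔ x)
  IsD Γ L X act d = HasDistLabeling Γ L X act d × (∀ r → HasDistLabeling Γ L X act r → d ≤ r)

module Submission where

open import Defs
open import Level using (Level)
open import Algebra.Bundles using (Group)
open import Data.Nat using (ℕ; _≤_)
open import Data.Product using (Σ; _×_; _,_)
open import Data.Nat.Properties using (≤-refl)
open import Relation.Unary using (Pred; _⊆_; _∈_)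

module _ {c ℓ : Level} (G : Group c ℓ) where
  open Group G

  ⊆-·ʳ : ∀ {p q} {S : Pred Carrier p} {T : Pred Carrier q} → ε ∈ S → T ⊆ _·_ G S T
  ⊆-·ʳ ε∈S {g} g∈T = ε , g , ε∈S , g∈T , sym (identityˡ g)

  HasDistLabeling-restrict : ∀ {p p′ q x} {Γ : Pred Carrier p} {Γ′ : Pred Carrier p′}
    {L : Pred Carrier q} {X : Set x} {act : Carrier → X → X} {r : ℕ} → Γ′ ⊆ Γ →
    HasDistLabeling G Γ L X act r → HasDistLabeling G Γ′ (_∩_ G L Γ′) X act r
  HasDistLabeling-restrict Γ′⊆Γ (φ , φ-labeling , preserved⇒L) =
    φ , φ-labeling , λ g g∈Γ′ g-preserves → preserved⇒L g (Γ′⊆Γ g∈Γ′) g-preserves , g∈Γ′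

-- The same labeling works: K ⊆ HK, so an element of K preserving it lies in H ∩ K.
mainTheorem16 : ∀ {c ℓ p x : Level} (G : Group c ℓ)
    (H K : Pred (Group.Carrier G) p) → IsSubgroup G H → IsSubgroup G K →
    SameSet G (_·_ G H K) (_·_ G K H) →
    (X : Set x) (act : Group.Carrier G → X → X) →
    IsActionOf G (_·_ G H K) X act → IsFaithful G (_·_ G H K) X act →
    (r : ℕ) → HasDistLabeling G (_·_ G H K) H X act r →
    Σ ℕ λ r′ → r′ ≤ r × HasDistLabeling G K (_∩_ G H K) X act r′
mainTheorem16 G H K H-subgroup _ _ X act _ _ r labeling =
  r , ≤-refl , HasDistLabeling-restrict G (⊆-·ʳ G (IsSubgroup.ε∈ H-subgroup)) labeling
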